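{- Let $G$ be a chordal graph. The following are equivalent: (i) for every induced subgraph $G'$ of $G$ and every two members $S_i, S_j$ ($i\neq j$) of the multiset $\mathbf{S}(G')$, $S_i$ is not a proper subset of $S_j$; (ii) $G$ is dart-free.
   Context: Graphs are simple, finite and undirected; a graph is chordal if it has no induced cycle of length at least four. A clique is a maximal set of pairwise adjacent vertices. A clique tree of a connected chordal graph $G$ is a tree $\mathcal{T}$ whose vertices are the cliques of $G$ such that for any two cliques $C_1,C_2$, every clique on the path from $C_1$ to $C_2$ in $\mathcal{T}$ contains $C_1\cap C_2$. Each edge of a clique tree is labeled by the intersection of its two endpoint cliques; these labels are exactly the minimal vertex separators. $\mathbf{S}(G)$ denotes the multiset of edge labels of a clique tree (taken over all connected components of $G$); it does not depend on the choice of clique tree. The dart is the graph on vertices $t,c,\ell,r,b$ with edges $tc, t\ell, tr, c\ell, cr, cb$ (a $K_4$ minus the edge $\ell r$, plus a pendant vertex $b$ attached to $c$). A graph is $H$-free if it has no induced subgraph isomorphic to $H$. -}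

module Defs where

open import Data.Nat using (ℕ; zero; suc; _≤_; _≡ᵇ_)
open import Data.Bool using (Bool; true; false; T; _∨_; _∧_)
open import Data.Fin using (Fin; toℕ; zero; suc)
open import Data.Fin.Subset using (Subset; _∈_; _⊆_; _⊂_; _∩_)
open import Data.List using (List; []; _∷_; length)
import Data.List.Membership.Propositional as LM
open import Data.List.Relation.Unary.Unique.Propositional using (Unique)
open import Data.Product using (Σ; ∃; _×_; _,_)
open import Data.Sum using (_⊎_)
open import Relation.Binary.PropositionalEquality using (_≡_; _≢_)
open import Relation.Nullary using (¬_)
open import Function.Definitions using (Injective)
open import Function.Bundles using (_⇔_)

record Graph (n : ℕ) : Set where
  field
    adj    : Fin n → Fin n → Bool
    sym    : ∀ x y → adj x y ≡ adj y x
    irrefl : ∀ x → adj x x ≡ false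
open Graph public

InducedEmbedding : {m n : ℕ} → (Fin m → Fin m → Bool) → (Fin n → Fin n → Bool) →
                   (Fin m → Fin n) → Set
InducedEmbedding h g f = Injective _≡_ _≡_ f × (∀ i j → h i j ≡ g (f i) (f j))

IsInducedSubgraph : {m n : ℕ} → Graph m → Graph n → Set
IsInducedSubgraph G' G = Σ _ (InducedEmbedding (adj G') (adj G))

-- Cycle adjacency on Fin m: i ~ j iff j = i+1 (mod m) or i = j+1 (mod m).
consecutive : {m : ℕ} → Fin m → Fin m → Bool
consecutive {m} i j = (suc (toℕ i) ≡ᵇ toℕ j) ∨ ((suc (toℕ i) ≡ᵇ m) ∧ (toℕ j ≡ᵇ 0))

cycAdj : {m : ℕ} → Fin m → Fin m → Bool
cycAdj i j = consecutive i j ∨ consecutive j i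

Chordal : {n : ℕ} → Graph n → Set
Chordal {n} G = ∀ (m : ℕ) → 4 ≤ m → (f : Fin m → Fin n) →
                ¬ InducedEmbedding (cycAdj {m}) (adj G) f

-- The dart on t=0, c=1, ℓ=2, r=3, b=4, edges tc tℓ tr cℓ cr cb.
dartAdj : Fin 5 → Fin 5 → Bool
dartAdj zero (suc zero) = true
dartAdj zero (suc (suc zero)) = true
dartAdj zero (suc (suc (suc zero))) = true
dartAdj (suc zero) zero = true
dartAdj (suc zero) (suc (suc zero)) = true
dartAdj (suc zero) (suc (suc (suc zero))) = true
dartAdj (suc zero) (suc (suc (suc (suc zero)))) = true
dartAdj (suc (suc zero)) zero = true
dartAdj (suc (suc zero)) (suc zero) = true
dartAdj (suc (suc (suc zero))) zero = true
dartAdj (suc (suc (suc zero))) (suc zero) = true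
dartAdj (suc (suc (suc (suc zero)))) (suc zero) = true
dartAdj _ _ = false

DartFree : {n : ℕ} → Graph n → Set
DartFree {n} G = ∀ (f : Fin 5 → Fin n) → ¬ InducedEmbedding dartAdj (adj G) f

IsComplete : {n : ℕ} → Graph n → Subset n → Set
IsComplete G S = ∀ x y → x ∈ S → y ∈ S → x ≢ y → T (adj G x y)

IsClique : {n : ℕ} → Graph n → Subset n → Set
IsClique G S = IsComplete G S × (∀ S' → IsComplete G S' → S ⊆ S' → S' ⊆ S)

-- Walk a b vs : vs is a walk from a to b (listing its vertices) w.r.t. adjacency r.
data Walk {k : ℕ} (r : Fin k → Fin k → Bool) : Fin k → Fin k → List (Fin k) → Set where
  here : ∀ {a} → Walk r a a (a ∷ [])
  step : ∀ {a b c vs} → T (r a b) → Walk r b c vs → Walk r a c (a ∷ vs)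

Acyclic : {k : ℕ} → Graph k → Set
Acyclic {k} F = ∀ (m : ℕ) → 3 ≤ m → (f : Fin m → Fin k) → Injective _≡_ _≡_ f →
                ¬ (∀ i j → T (cycAdj i j) → T (adj F (f i) (f j)))

-- A clique forest of G: a forest on the cliques of G whose trees are exactly
-- the clique trees of the connected components of G.
record CliqueForest {n : ℕ} (G : Graph n) : Set where
  field
    k         : ℕ
    clq       : Fin k → Subset n
    clq-clique : ∀ i → IsClique G (clq i)
    clq-inj   : Injective _≡_ _≡_ clq
    clq-all   : ∀ S → IsClique G S → ∃ λ i → clq i ≡ S
    tree      : Graph k
    acyclic   : Acyclic tree
    components : ∀ i j → (∃ λ vs → Walk (adj tree) i j vs) ⇔
                 (∀ x y → x ∈ clq i → y ∈ clq j → ∃ λ ws → Walk (adj G) x y ws)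
    path-prop : ∀ i j vs → Walk (adj tree) i j vs → Unique vs →
                ∀ l → l LM.∈ vs → (clq i ∩ clq j) ⊆ clq l
open CliqueForest public

SameEdge : {k : ℕ} → Fin k → Fin k → Fin k → Fin k → Set
SameEdge a b c d = (a ≡ c × b ≡ d) ⊎ (a ≡ d × b ≡ c)

-- Property (i): for every induced subgraph G' and two distinct members of S(G')
-- (labels of two distinct edges of a clique forest of G'), neither is a proper subset of the other.
NoProperSepContainment : {n : ℕ} → Graph n → Set
NoProperSepContainment G =
  ∀ (m : ℕ) (G' : Graph m) → IsInducedSubgraph G' G → (F : CliqueForest G') →
  ∀ a b c d → T (adj (tree F) a b) → T (adj (tree F) c d) → ¬ SameEdge a b c d →
  ¬ ((clq F a ∩ clq F b) ⊂ (clq F c ∩ clq F d))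

module Submission where

-- (ii) ⇒ (i).  Let a — b, c — d be distinct tree edges with C a ∩ C b ⊂ C c ∩ C d.
-- Removing a — b splits its tree into an a-side and a b-side; c and d lie on
-- the same side, else the tree path from c to d would run through a — b.  The
-- clique-tree property gives the key fact (adjacent-across): adjacent vertices
-- of cliques on opposite sides of an edge cannot both avoid its label.  With
-- s in both labels, x ∈ (C c ∩ C d) ∖ (C a ∩ C b), ℓ ∈ C c ∖ C d, r ∈ C d ∖ C c
-- and b′ ∈ C b ∖ C a, the vertices x, s, ℓ, r, b′ induce a dart.
-- (i) ⇒ (ii).  The dart has the star-shaped clique forest {c,b} — {t,c,ℓ} — {t,c,r}
-- with labels {c} ⊂ {t,c}; its axioms follow from general lemmas on stars and
-- on enumerating cliques, plus decision procedures on the five-vertex graph.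

open import Defs hiding (sym)
open import Data.Nat using (ℕ; zero; suc; _≤_; _<_; _+_; z≤n; s≤s)
open import Data.Nat.Properties using (≡ᵇ⇒≡; suc-injective; +-suc; +-monoʳ-≤; ≤-trans; <⇒≱; <-≤-trans; m≤m+n)
open import Data.Bool using (Bool; true; false; T; _xor_)
import Data.Bool as Bool
open import Data.Bool.Properties using (T-∨; T-∧; xor-comm; xor-same)
open import Data.Fin using (Fin; zero; suc; toℕ; _≟_)
open import Data.Fin.Properties using (any?; all?)
open import Data.Fin.Subset using (Subset; _∪_; _∩_; ⁅_⁆; ∣_∣; _∈_; _∉_; _⊆_; _⊂_; inside; outside)
open import Data.Vec using ([]; _∷_)
open import Data.Fin.Subset.Properties
  using (x∈p∪q⁺; x∈p∪q⁻; p⊆p∪q; x∈⁅x⁆; x∈⁅y⁆⇒x≡y; p⊂q⇒∣p∣<∣q∣; ∣p∣≤n; ⊆-antisym; x∈p∩q⁺; x∈p∩q⁻; nonempty?; p∩q⊆p; p∩q⊆q; _⊆?_; _⊂?_; anySubset?)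
  renaming (_∈?_ to _∈ₛ?_)
open import Data.List using (List; []; _∷_; length; _++_; [_]; lookup)
open import Data.List.Membership.Propositional using () renaming (_∈_ to _∈ₗ_; _∉_ to _∉ₗ_)
open import Data.List.Membership.Propositional.Properties using (∈-++⁺ˡ; ∈-++⁺ʳ; ∈-++⁻; ∈-lookup)
import Data.List.Membership.DecPropositional as DecMembership
open import Data.List.Relation.Unary.Any using (here; there)
import Data.List.Relation.Unary.All as All
open import Data.List.Relation.Unary.All using ([]; _∷_)
open import Data.List.Relation.Unary.All.Properties using (¬Any⇒All¬)
open import Data.List.Relation.Unary.AllPairs using ([]; _∷_)
open import Data.List.Relation.Unary.Unique.Propositional using (Unique)
open import Data.List.Relation.Unary.Unique.Propositional.Properties using (++⁺; Unique[x∷xs]⇒x∉xs)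
open import Data.Product using (Σ; ∃; _×_; _,_; proj₁; proj₂)
open import Data.Sum using (_⊎_; inj₁; inj₂; map₁; map₂)
open import Data.Empty using (⊥; ⊥-elim)
open import Relation.Binary.PropositionalEquality using (_≡_; _≢_; refl; sym; trans; cong; subst; module ≡-Reasoning)
open import Relation.Nullary using (¬_; Dec; does; yes; no)
open import Relation.Nullary.Decidable using (¬?; _×-dec_; _⊎-dec_; _→-dec_; T?; from-yes; decidable-stable; dec-true; dec-false)
open import Function.Base using (id)
open import Function.Bundles using (_⇔_; mk⇔; Equivalence)
open import Function.Definitions using (Injective)

-- Inclusion of vertex lists, recording that a derived walk only uses vertices of a given one.
infix 4 _⊆ₗ_
_⊆ₗ_ : {k : ℕ} → List (Fin k) → List (Fin k) → Set
xs ⊆ₗ ys = ∀ {v} → v ∈ₗ xs → v ∈ₗ ys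

∷-unique : ∀ {k} {x : Fin k} {xs} → x ∉ₗ xs → Unique xs → Unique (x ∷ xs)
∷-unique x∉ u = ¬Any⇒All¬ _ x∉ ∷ u

module Walks {k : ℕ} (r : Fin k → Fin k → Bool) where

  Connected : Fin k → Fin k → Set
  Connected a b = ∃ λ vs → Walk r a b vs

  head∈ : ∀ {a b vs} → Walk r a b vs → a ∈ₗ vs
  head∈ here = here refl
  head∈ (step _ _) = here refl

  last∈ : ∀ {a b vs} → Walk r a b vs → b ∈ₗ vs
  last∈ here = here refl
  last∈ (step _ w) = there (last∈ w)

  record PathWithin (a b : Fin k) (vs : List (Fin k)) : Set where
    constructor path
    field
      verts  : List (Fin k)
      walk   : Walk r a b verts
      simple : Unique verts
      within : verts ⊆ₗ vs

  join : ∀ {a b c vs ws} → Walk r a b vs → Walk r b c ws →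
         ∃ λ us → Walk r a c us × (∀ {v} → v ∈ₗ us → v ∈ₗ vs ⊎ v ∈ₗ ws)
  join here w = _ , w , inj₂
  join (step e p) w with join p w
  ... | _ , p' , from = _ , step e p' , λ { (here refl) → inj₁ (here refl)
                                          ; (there q) → map₁ there (from q) }

  connected-trans : ∀ {a b c} → Connected a b → Connected b c → Connected a c
  connected-trans (_ , w₁) (_ , w₂) = let (_ , w , _) = join w₁ w₂ in _ , w

  concat-via : ∀ {a b c d vs ws} → Walk r a b vs → T (r b c) → Walk r c d ws → Walk r a d (vs ++ ws)
  concat-via here e w = step e w
  concat-via (step e' p) e w = step e' (concat-via p e w)

  suffix-from : ∀ {x c v ws} → Walk r x c ws → Unique ws → v ∈ₗ ws → PathWithin v c ws
  suffix-from here u (here refl) = path _ here u id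
  suffix-from (step e w) u (here refl) = path _ (step e w) u id
  suffix-from here u (there ())
  suffix-from (step e w) (_ ∷ u) (there m) with suffix-from w u m
  ... | path ws' w' u' within = path ws' w' u' (λ z → there (within z))

  prefix-to : ∀ {x c v ws} → Walk r x c ws → Unique ws → v ∈ₗ ws → PathWithin x v ws
  prefix-to here u (here refl) = path _ here ([] ∷ []) id
  prefix-to (step _ _) u (here refl) = path _ here ([] ∷ []) λ { (here refl) → here refl }
  prefix-to here u (there ())
  prefix-to (step e w) (x∉ ∷ u) (there m) with prefix-to w u m
  ... | path ws' w' u' within =
    path _ (step e w') (∷-unique (λ q → All.lookup x∉ (within q) refl) u')
         λ { (here refl) → here refl ; (there q) → there (within q) }

  -- Every walk contains a simple path between its end points: cut out the
  -- loop whenever the current vertex reappears later.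
  simplify : ∀ {a b vs} → Walk r a b vs → PathWithin a b vs
  simplify here = path _ here ([] ∷ []) id
  simplify {a} (step e w) with simplify w
  ... | path ws w' u within with DecMembership._∈?_ _≟_ a ws
  ...   | no a∉ = path (a ∷ ws) (step e w') (∷-unique a∉ u)
                       λ { (here refl) → here refl ; (there q) → there (within q) }
  ...   | yes a∈ with suffix-from w' u a∈
  ...     | path ws' w'' u' within' = path ws' w'' u' (λ z → there (within (within' z)))

module SymmetricWalks {k : ℕ} (r : Fin k → Fin k → Bool) (r-sym : ∀ x y → r x y ≡ r y x) where
  open Walks r

  flipT : ∀ {x y} → T (r x y) → T (r y x)
  flipT {x} {y} = subst T (r-sym x y)

  reverse : ∀ {a b vs} → Walk r a b vs → Unique vs → Σ (PathWithin b a vs) λ p → vs ⊆ₗ PathWithin.verts p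
  reverse here u = path _ here u id , id
  reverse {a} (step {vs = rest} e w) (a∉ ∷ u) with reverse w u
  ... | path ws w' u' within , covers =
    path (ws ++ [ a ]) (concat-via w' (flipT e) here)
         (++⁺ u' ([] ∷ []) λ { (p , here refl) → All.lookup a∉ (within p) refl })
         from-appended ,
    λ { (here refl) → ∈-++⁺ʳ ws (here refl) ; (there q) → ∈-++⁺ˡ (covers q) }
    where
      from-appended : ws ++ [ a ] ⊆ₗ a ∷ rest
      from-appended q with ∈-++⁻ ws q
      ... | inj₁ q' = there (within q')
      ... | inj₂ (here refl) = here refl

  Branching : Fin k → Set
  Branching l = ∃ λ x → ∃ λ y → x ≢ y × T (r l x) × T (r l y)

  on-simple-path : ∀ {a b l vs} → Walk r a b vs → Unique vs → l ∈ₗ vs →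
                   l ≡ a ⊎ l ≡ b ⊎ (a ≢ b × Branching l)
  on-simple-path here _ (here refl) = inj₁ refl
  on-simple-path (step _ _) _ (here refl) = inj₁ refl
  on-simple-path {a} (step e w) (a∉ ∷ u) (there l∈) =
    inj₂ (map₂ (λ br → (All.lookup a∉ (last∈ w)) , br)
                       (after e w (λ a∈ → All.lookup a∉ a∈ refl) u l∈))
    where
      after : ∀ {p q c l ws} → T (r p q) → Walk r q c ws → p ∉ₗ ws → Unique ws → l ∈ₗ ws → l ≡ c ⊎ Branching l
      after _ here _ _ (here refl) = inj₁ refl
      after {p} e (step e' w) p∉ _ (here refl) =
        inj₂ (p , _ , (λ { refl → p∉ (there (head∈ w)) }) , flipT e , e')
      after e (step e' w) _ u@(_ ∷ u') (there l∈) = after e' w (Unique[x∷xs]⇒x∉xs u) u' l∈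

  hub-connects : (h : Fin k) → (∀ x → x ≢ h → T (r x h)) → ∀ x y → Connected x y
  hub-connects h to-hub x y with x ≟ y | x ≟ h | y ≟ h
  ... | yes refl | _      | _      = _ , here
  ... | no x≢y   | yes refl | y≟h  = _ , step (flipT (to-hub y (λ y≡x → x≢y (sym y≡x)))) here
  ... | no _     | no x≢h | yes refl = _ , step (to-hub x x≢h) here
  ... | no _     | no x≢h | no y≢h  = _ , step (to-hub x x≢h) (step (flipT (to-hub y y≢h)) here)

module Forest {k : ℕ} (F : Graph k) (no-cycle : Acyclic F) where
  private
    r = adj F
  open Walks r
  open SymmetricWalks r (Graph.sym F)

  -- Reading the vertex list of a walk as a map Fin (length vs) → Fin k,
  -- consecutive positions are adjacent and the ends are the end points.
  lookup-head : ∀ {a b vs} → Walk r a b vs → (i : Fin (length vs)) → toℕ i ≡ 0 → lookup vs i ≡ a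
  lookup-head here zero _ = refl
  lookup-head (step _ _) zero _ = refl
  lookup-head (step _ _) (suc i) ()

  lookup-last : ∀ {a b vs} → Walk r a b vs → (i : Fin (length vs)) → suc (toℕ i) ≡ length vs → lookup vs i ≡ b
  lookup-last here zero _ = refl
  lookup-last (step _ here) zero ()
  lookup-last (step _ (step _ _)) zero ()
  lookup-last (step _ w) (suc i) eq = lookup-last w i (suc-injective eq)

  lookup-step : ∀ {a b vs} → Walk r a b vs → (i j : Fin (length vs)) → suc (toℕ i) ≡ toℕ j →
                T (r (lookup vs i) (lookup vs j))
  lookup-step here zero zero ()
  lookup-step (step e w) zero (suc j) eq = subst (λ z → T (r _ z)) (sym (lookup-head w j (suc-injective (sym eq)))) e
  lookup-step (step e w) (suc i) (suc j) eq = lookup-step w i j (suc-injective eq)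
  lookup-step (step e w) _ zero ()

  lookup-injective : ∀ {vs : List (Fin k)} → Unique vs → Injective _≡_ _≡_ (lookup vs)
  lookup-injective {_ ∷ _} _ {zero} {zero} _ = refl
  lookup-injective {_ ∷ _} (x∉ ∷ _) {zero} {suc j} eq = ⊥-elim (All.lookup x∉ (∈-lookup j) eq)
  lookup-injective {_ ∷ _} (x∉ ∷ _) {suc i} {zero} eq = ⊥-elim (All.lookup x∉ (∈-lookup i) (sym eq))
  lookup-injective {_ ∷ _} (_ ∷ u) {suc i} {suc j} eq = cong suc (lookup-injective u eq)

  no-closed-path : ∀ {a b vs} → Walk r a b vs → Unique vs → T (r b a) → 3 ≤ length vs → ⊥
  no-closed-path {a} {b} {vs} w u ba len = no-cycle (length vs) len (lookup vs) (lookup-injective u) edges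
    where
      forward : ∀ i j → T (consecutive i j) → T (r (lookup vs i) (lookup vs j))
      forward i j c with Equivalence.to T-∨ c
      ... | inj₁ next = lookup-step w i j (≡ᵇ⇒≡ _ _ next)
      ... | inj₂ wrap with Equivalence.to T-∧ wrap
      ...   | i-last , j-first
            rewrite lookup-last w i (≡ᵇ⇒≡ _ _ i-last) | lookup-head w j (≡ᵇ⇒≡ _ _ j-first) = ba
      edges : ∀ i j → T (cycAdj i j) → T (r (lookup vs i) (lookup vs j))
      edges i j c with Equivalence.to T-∨ c
      ... | inj₁ ij = forward i j ij
      ... | inj₂ ji = flipT (forward j i ji)

  walk-length : ∀ {u w vs} → Walk r u w vs → u ≢ w → 2 ≤ length vs
  walk-length here u≢w = ⊥-elim (u≢w refl)
  walk-length (step _ here) _ = s≤s (s≤s z≤n)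
  walk-length (step _ (step _ _)) _ = s≤s (s≤s z≤n)

  no-shortcut : ∀ {i u w vs} → Walk r u w vs → Unique vs → i ∉ₗ vs → u ≢ w → T (r i u) → T (r w i) → ⊥
  no-shortcut p u i∉ u≢w iu wi = no-closed-path (step iu p) (∷-unique i∉ u) wi (s≤s (walk-length p u≢w))

  -- Simple paths with the same end points coincide: if the first steps differ,
  -- the two remainders contain a simple path from the one second vertex to the
  -- other avoiding the start, which closes a cycle with it.
  unique-path : ∀ {i j p q} → Walk r i j p → Unique p → Walk r i j q → Unique q → p ≡ q
  unique-path here _ here _ = refl
  unique-path here _ (step _ w) (i∉ ∷ _) = ⊥-elim (All.lookup i∉ (last∈ w) refl)
  unique-path (step _ w) (i∉ ∷ _) here _ = ⊥-elim (All.lookup i∉ (last∈ w) refl)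
  unique-path {i} (step {b = u} e p) (i∉p ∷ up) (step {b = w} e' q) (i∉q ∷ uq) with u ≟ w
  ... | yes refl = cong (i ∷_) (unique-path p up q uq)
  ... | no u≢w with reverse q uq
  ...   | path qs q' _ qs⊆q , _ with join p q'
  ...     | _ , pq , from with simplify pq
  ...       | path s ws us s⊆pq = ⊥-elim (no-shortcut ws us i∉ u≢w e (flipT e'))
    where
      i∉ : i ∉ₗ s
      i∉ m with from (s⊆pq m)
      ... | inj₁ m∈p = All.lookup i∉p m∈p refl
      ... | inj₂ m∈q = All.lookup i∉q (qs⊆q m∈q) refl

module Cliques {m : ℕ} (G : Graph m) where
  private
    A = adj G

  flipA : ∀ {x y} → T (A x y) → T (A y x)
  flipA {x} {y} = subst T (Graph.sym G x y)

  complete? : (S : Subset m) → Dec (IsComplete G S)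
  complete? S = all? λ x → all? λ y → (x ∈ₛ? S) →-dec (y ∈ₛ? S) →-dec ¬? (x ≟ y) →-dec T? (A x y)

  Extends : Subset m → Fin m → Set
  Extends S v = v ∉ S × (∀ x → x ∈ S → T (A v x))

  extends? : ∀ S v → Dec (Extends S v)
  extends? S v = ¬? (v ∈ₛ? S) ×-dec all? (λ x → (x ∈ₛ? S) →-dec T? (A v x))

  add-complete : ∀ {S v} → IsComplete G S → Extends S v → IsComplete G (S ∪ ⁅ v ⁆)
  add-complete {S} {v} complete (_ , v~S) x y x∈ y∈ x≢y with x∈p∪q⁻ S ⁅ v ⁆ x∈ | x∈p∪q⁻ S ⁅ v ⁆ y∈
  ... | inj₁ xS | inj₁ yS = complete x y xS yS x≢y
  ... | inj₁ xS | inj₂ yv rewrite x∈⁅y⁆⇒x≡y v yv = flipA (v~S x xS)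
  ... | inj₂ xv | inj₁ yS rewrite x∈⁅y⁆⇒x≡y v xv = v~S y yS
  ... | inj₂ xv | inj₂ yv = ⊥-elim (x≢y (trans (x∈⁅y⁆⇒x≡y v xv) (sym (x∈⁅y⁆⇒x≡y v yv))))

  saturated-clique : ∀ {S} → IsComplete G S → (∀ v → ¬ Extends S v) → IsClique G S
  saturated-clique {S} complete none = complete , maximal
    where
      maximal : ∀ S' → IsComplete G S' → S ⊆ S' → S' ⊆ S
      maximal S' complete' S⊆S' {y} y∈S' with y ∈ₛ? S
      ... | yes y∈S = y∈S
      ... | no y∉S = ⊥-elim (none y (y∉S , λ x x∈S →
                       complete' y x y∈S' (S⊆S' x∈S) λ y≡x → y∉S (subst (_∈ S) (sym y≡x) x∈S)))

  -- Greedy extension, adding vertices while possible.  The fuel bounds the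
  -- number of additions: with none left, S already has all m vertices.
  extend : ∀ fuel (S : Subset m) → IsComplete G S → m ≤ fuel + ∣ S ∣ → ∃ λ C → IsClique G C × S ⊆ C
  extend fuel S complete bound with any? (extends? S)
  ... | no none = S , saturated-clique complete (λ v e → none (v , e)) , id
  ... | yes (v , ext) = grow fuel bound
    where
      S' = S ∪ ⁅ v ⁆
      larger : ∣ S ∣ < ∣ S' ∣
      larger = p⊂q⇒∣p∣<∣q∣ (p⊆p∪q ⁅ v ⁆ , v , x∈p∪q⁺ (inj₂ (x∈⁅x⁆ v)) , proj₁ ext)
      grow : ∀ f → m ≤ f + ∣ S ∣ → ∃ λ C → IsClique G C × S ⊆ C
      grow zero bound = ⊥-elim (<⇒≱ (<-≤-trans larger (∣p∣≤n S')) bound)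
      grow (suc f) bound with extend f S' (add-complete complete ext)
                                (≤-trans bound (subst (_≤ f + ∣ S' ∣) (+-suc f ∣ S ∣) (+-monoʳ-≤ f larger)))
      ... | C , clique , S'⊆C = C , clique , λ z → S'⊆C (p⊆p∪q ⁅ v ⁆ z)

  extend-to-clique : (S : Subset m) → IsComplete G S → ∃ λ C → IsClique G C × S ⊆ C
  extend-to-clique S complete = extend m S complete (m≤m+n m ∣ S ∣)

  singleton-complete : (x : Fin m) → IsComplete G ⁅ x ⁆
  singleton-complete x a b a∈ b∈ a≢b = ⊥-elim (a≢b (trans (x∈⁅y⁆⇒x≡y x a∈) (sym (x∈⁅y⁆⇒x≡y x b∈))))

  edge-complete : ∀ {u v} → T (A u v) → IsComplete G (⁅ u ⁆ ∪ ⁅ v ⁆)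
  edge-complete {u} {v} uv = add-complete (singleton-complete u) (v∉ , v~u)
    where
      v∉ : v ∉ ⁅ u ⁆
      v∉ v∈ with x∈⁅y⁆⇒x≡y u v∈
      ... | refl = subst T (Graph.irrefl G v) uv
      v~u : ∀ x → x ∈ ⁅ u ⁆ → T (A v x)
      v~u x x∈ rewrite x∈⁅y⁆⇒x≡y u x∈ = flipA uv

module CliqueForestFacts {m : ℕ} (G : Graph m) (F : CliqueForest G) where
  open Cliques G
  private
    A = adj G
    tr = adj (tree F)
    C = clq F
  open Walks tr
  open SymmetricWalks tr (Graph.sym (tree F))
  open Forest (tree F) (acyclic F)

  tree-irrefl : ∀ {a b} → T (tr a b) → a ≢ b
  tree-irrefl {a} ab refl = subst T (Graph.irrefl (tree F) a) ab

  clique-complete : ∀ i {x y} → x ∈ C i → y ∈ C i → x ≢ y → T (A x y)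
  clique-complete i {x} {y} = proj₁ (clq-clique F i) x y

  clique-containing : (S : Subset m) → IsComplete G S → ∃ λ i → S ⊆ C i
  clique-containing S complete with extend-to-clique S complete
  ... | D , clique , S⊆D with clq-all F D clique
  ...   | i , refl = i , S⊆D

  edge-in-clique : ∀ {u v} → T (A u v) → ∃ λ i → u ∈ C i × v ∈ C i
  edge-in-clique {u} {v} uv with clique-containing (⁅ u ⁆ ∪ ⁅ v ⁆) (edge-complete uv)
  ... | i , sub = i , sub (x∈p∪q⁺ (inj₁ (x∈⁅x⁆ u))) , sub (x∈p∪q⁺ (inj₂ (x∈⁅x⁆ v)))

  -- Cliques of a graph with at least one vertex x are nonempty (the empty set lies below ⁅ x ⁆).
  clique-nonempty : ∀ i → Fin m → ∃ λ u → u ∈ C i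
  clique-nonempty i x with nonempty? (C i)
  ... | yes nonempty = nonempty
  ... | no empty = x , proj₂ (clq-clique F i) ⁅ x ⁆ (singleton-complete x)
                          (λ y∈ → ⊥-elim (empty (_ , y∈))) (x∈⁅x⁆ x)

  -- Distinct cliques are incomparable, so each has a vertex outside the other.
  clique-difference : ∀ {i j} → i ≢ j → ∃ λ y → y ∈ C j × y ∉ C i
  clique-difference {i} {j} i≢j with any? (λ y → (y ∈ₛ? C j) ×-dec ¬? (y ∈ₛ? C i))
  ... | yes witness = witness
  ... | no none = ⊥-elim (i≢j (clq-inj F (⊆-antisym Ci⊆Cj Cj⊆Ci)))
    where
      Cj⊆Ci : C j ⊆ C i
      Cj⊆Ci {y} y∈Cj with y ∈ₛ? C i
      ... | yes y∈Ci = y∈Ci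
      ... | no y∉Ci = ⊥-elim (none (y , y∈Cj , y∉Ci))
      Ci⊆Cj : C i ⊆ C j
      Ci⊆Cj = proj₂ (clq-clique F j) (C i) (proj₁ (clq-clique F i)) Cj⊆Ci

  sharing-connected : ∀ {i j v} → v ∈ C i → v ∈ C j → Connected i j
  sharing-connected {i} {j} {v} v∈i v∈j = Equivalence.from (components F i j) λ x y x∈i y∈j →
    Walks.connected-trans A (within i x∈i v∈i) (within j v∈j y∈j)
    where
      within : ∀ l {x y} → x ∈ C l → y ∈ C l → Walks.Connected A x y
      within l {x} {y} x∈ y∈ with x ≟ y
      ... | yes refl = _ , here
      ... | no x≢y = _ , step (clique-complete l x∈ y∈ x≢y) here

  -- Removing the tree edge a — b: the clique i lies on a's side when the
  -- simple tree path from a to i avoids b.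
  record OnSide (a b i : Fin (k F)) : Set where
    constructor side
    field
      verts  : List (Fin (k F))
      walk   : Walk tr a i verts
      simple : Unique verts
      avoids : b ∉ₗ verts

  own-side : ∀ {a b} → a ≢ b → OnSide a b a
  own-side a≢b = side _ here ([] ∷ []) λ { (here b≡a) → a≢b (sym b≡a) }

  sides-disjoint : ∀ {a b i} → T (tr a b) → OnSide a b i → OnSide b a i → ⊥
  sides-disjoint ab (side p wp up b∉p) (side q wq uq a∉q) =
    a∉q (subst (_ ∈ₗ_) (unique-path (step (flipT ab) wp) (∷-unique b∉p up) wq uq) (there (head∈ wp)))

  side-of : ∀ {a b i} → T (tr a b) → Connected a i → OnSide a b i ⊎ OnSide b a i
  side-of {a} {b} ab (_ , w) with simplify w
  ... | path p wp up _ with DecMembership._∈?_ _≟_ b p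
  ...   | no b∉p = inj₁ (side p wp up b∉p)
  side-of ab _ | path _ here _ _ | yes (here refl) = ⊥-elim (tree-irrefl ab refl)
  side-of ab _ | path _ (step _ _) _ _ | yes (here refl) = ⊥-elim (tree-irrefl ab refl)
  side-of ab _ | path _ (step _ w) (a∉ ∷ u) _ | yes (there b∈) with suffix-from w u b∈
  ... | path q wq uq within = inj₂ (side q wq uq λ a∈q → All.lookup a∉ (within a∈q) refl)

  path-across : ∀ {a b i j} → T (tr a b) → OnSide a b i → OnSide b a j →
                Σ (List (Fin (k F))) λ L → Walk tr i j L × Unique L × a ∈ₗ L × b ∈ₗ L
  path-across {a} {b} ab (side p wp up b∉p) (side q wq uq a∉q) with reverse wp up
  ... | path ps wps ups ps⊆p , p⊆ps =
    ps ++ q , concat-via wps ab wq , ++⁺ ups uq disjoint , ∈-++⁺ˡ (p⊆ps (head∈ wp)) , ∈-++⁺ʳ ps (head∈ wq)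
    where
      disjoint : ∀ {v} → ¬ (v ∈ₗ ps × v ∈ₗ q)
      disjoint (v∈ps , v∈q) with prefix-to wp up (ps⊆p v∈ps) | prefix-to wq uq v∈q
      ... | path p' wp' up' p'⊆p | path q' wq' uq' q'⊆q =
        sides-disjoint ab (side p' wp' up' λ z → b∉p (p'⊆p z)) (side q' wq' uq' λ z → a∉q (q'⊆q z))

  separator-across : ∀ {a b i j v} → T (tr a b) → OnSide a b i → OnSide b a j →
                     v ∈ C i → v ∈ C j → v ∈ C a × v ∈ C b
  separator-across ab sa sb v∈i v∈j with path-across ab sa sb
  ... | L , w , u , a∈ , b∈ = path-prop F _ _ L w u _ a∈ (x∈p∩q⁺ (v∈i , v∈j))
                            , path-prop F _ _ L w u _ b∈ (x∈p∩q⁺ (v∈i , v∈j))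

  adjacent-across : ∀ {a b i j y z} → T (tr a b) → OnSide a b i → OnSide b a j →
                    y ∈ C i → z ∈ C j → T (A y z) → (y ∈ C a × y ∈ C b) ⊎ (z ∈ C a × z ∈ C b)
  adjacent-across ab sa@(side p wp _ _) sb y∈i z∈j yz with edge-in-clique yz
  ... | e , y∈e , z∈e with side-of ab (connected-trans (_ , wp) (sharing-connected y∈i y∈e))
  ...   | inj₁ se = inj₂ (separator-across ab se sb z∈e z∈j)
  ...   | inj₂ sb' = inj₁ (separator-across ab sa sb' y∈i y∈e)

  -- The label of every tree edge a — b is nonempty: follow a walk of G from C a
  -- to C b, keeping a clique on a's side that contains the current vertex.
  separator-nonempty : ∀ {a b} → T (tr a b) → Fin m → ∃ λ s → s ∈ C a × s ∈ C b
  separator-nonempty {a} {b} ab x = finish (follow walk-ab (a , start∈a , own-side (tree-irrefl ab)))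
    where
      InASide : Fin m → Set
      InASide v = ∃ λ i → v ∈ C i × OnSide a b i
      Label : Set
      Label = ∃ λ s → s ∈ C a × s ∈ C b
      follow : ∀ {u w ws} → Walk A u w ws → InASide u → Label ⊎ InASide w
      follow here h = inj₂ h
      follow (step vv' w) (i , v∈i , sa@(side _ wp _ _)) with edge-in-clique vv'
      ... | e , v∈e , v'∈e with side-of ab (connected-trans (_ , wp) (sharing-connected v∈i v∈e))
      ...   | inj₁ se = follow w (e , v'∈e , se)
      ...   | inj₂ sb = inj₁ (_ , separator-across ab sa sb v∈i v∈e)
      start = proj₁ (clique-nonempty a x)
      start∈a = proj₂ (clique-nonempty a x)
      end = proj₁ (clique-nonempty b x)
      end∈b = proj₂ (clique-nonempty b x)
      walk-ab = proj₂ (Equivalence.to (components F a b) (_ , step ab here) start end start∈a end∈b)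
      finish : Label ⊎ InASide end → Label
      finish (inj₁ label) = label
      finish (inj₂ (i , end∈i , sa)) =
        end , separator-across ab sa (own-side (λ b≡a → tree-irrefl ab (sym b≡a))) end∈i end∈b

  -- A simple tree path between the ends of a tree edge c — d is that edge, so
  -- two distinct vertices on it form the edge c — d.
  on-edge-path : ∀ {a b c d L} → a ≢ b → T (tr c d) → Walk tr c d L → Unique L →
                 a ∈ₗ L → b ∈ₗ L → SameEdge a b c d
  on-edge-path {c = c} {d} a≢b cd w u a∈ b∈
    with unique-path w u (step cd here) (((λ c≡d → tree-irrefl cd c≡d) ∷ []) ∷ [] ∷ [])
  ... | refl with a∈ | b∈
  ...   | here refl | here refl = ⊥-elim (a≢b refl)
  ...   | here refl | there (here refl) = inj₁ (refl , refl)
  ...   | there (here refl) | here refl = inj₂ (refl , refl)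
  ...   | there (here refl) | there (here refl) = ⊥-elim (a≢b refl)

record DartIn {m : ℕ} (G : Graph m) : Set where
  field
    t c ℓ r b : Fin m
    t~c : T (adj G t c)
    t~ℓ : T (adj G t ℓ)
    t~r : T (adj G t r)
    c~ℓ : T (adj G c ℓ)
    c~r : T (adj G c r)
    c~b : T (adj G c b)
    ℓ≁r : ¬ T (adj G ℓ r)
    t≁b : ¬ T (adj G t b)
    ℓ≁b : ¬ T (adj G ℓ b)
    r≁b : ¬ T (adj G r b)
    ℓ≢r : ℓ ≢ r

-- Here both C c and C d lie on a's side of
-- a — b; s is in both labels and x only in the second.  The dart is
-- t = x, c = s, ℓ ∈ C c ∖ C d, r ∈ C d ∖ C c, b ∈ C b ∖ C a: the edges come from
-- the cliques C c, C d, C b, and every non-edge is an edge across a — b or c — d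
-- whose ends avoid its label (adjacent-across).
module DartFromLabels {m : ℕ} (G : Graph m) (F : CliqueForest G) where
  open Cliques G
  open CliqueForestFacts G F
  private
    tr = adj (tree F)
    C = clq F
  open SymmetricWalks tr (Graph.sym (tree F)) using (flipT)

  distinct : ∀ {i u v} → u ∈ C i → v ∉ C i → u ≢ v
  distinct u∈ v∉ refl = v∉ u∈

  nested-labels-dart : ∀ {a b c d s x} → T (tr a b) → T (tr c d) → OnSide a b c → OnSide a b d →
                       (∀ {y} → y ∈ C a → y ∈ C b → y ∈ C c × y ∈ C d) →
                       s ∈ C a → s ∈ C b → x ∈ C c → x ∈ C d → ¬ (x ∈ C a × x ∈ C b) → DartIn G
  nested-labels-dart {a} {b} {c} {d} {s} {x} ab cd c-side d-side nested s∈a s∈b x∈c x∈d x∉ab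
    with clique-difference (λ d≡c → tree-irrefl cd (sym d≡c)) | clique-difference (tree-irrefl cd)
       | clique-difference (tree-irrefl ab)
  ... | ℓ , ℓ∈c , ℓ∉d | r , r∈d , r∉c | b′ , b′∈b , b′∉a = record
    { t = x ; c = s ; ℓ = ℓ ; r = r ; b = b′
    ; t~c = clique-complete c x∈c s∈c (λ x≡s → x∉ab (subst (λ z → z ∈ C a × z ∈ C b) (sym x≡s) (s∈a , s∈b)))
    ; t~ℓ = clique-complete c x∈c ℓ∈c (distinct x∈d ℓ∉d)
    ; t~r = clique-complete d x∈d r∈d (distinct x∈c r∉c)
    ; c~ℓ = clique-complete c s∈c ℓ∈c (distinct s∈d ℓ∉d)
    ; c~r = clique-complete d s∈d r∈d (distinct s∈c r∉c)
    ; c~b = clique-complete b s∈b b′∈b (distinct s∈a b′∉a)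
    ; ℓ≁r = ℓ≁r
    ; t≁b = only-b-side c-side x∈c x∉ab
    ; ℓ≁b = only-b-side c-side ℓ∈c (λ (ℓ∈a , ℓ∈b) → ℓ∉d (proj₂ (nested ℓ∈a ℓ∈b)))
    ; r≁b = only-b-side d-side r∈d (λ (r∈a , r∈b) → r∉c (proj₁ (nested r∈a r∈b)))
    ; ℓ≢r = distinct ℓ∈c r∉c
    }
    where
      s∈c = proj₁ (nested s∈a s∈b)
      s∈d = proj₂ (nested s∈a s∈b)
      ℓ≁r : ¬ T (adj G ℓ r)
      ℓ≁r ℓ~r with adjacent-across cd (own-side (tree-irrefl cd)) (own-side (λ d≡c → tree-irrefl cd (sym d≡c))) ℓ∈c r∈d ℓ~r
      ... | inj₁ (_ , ℓ∈d) = ℓ∉d ℓ∈d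
      ... | inj₂ (r∈c , _) = r∉c r∈c
      only-b-side : ∀ {i y} → OnSide a b i → y ∈ C i → ¬ (y ∈ C a × y ∈ C b) → ¬ T (adj G y b′)
      only-b-side sa y∈i y∉ab y~b′ with adjacent-across ab sa (own-side (λ b≡a → tree-irrefl ab (sym b≡a))) y∈i b′∈b y~b′
      ... | inj₁ y∈ab = y∉ab y∈ab
      ... | inj₂ (b′∈a , _) = b′∉a b′∈a

  proper-containment-dart : ∀ {a b c d} → T (tr a b) → T (tr c d) → ¬ SameEdge a b c d →
                            (C a ∩ C b) ⊂ (C c ∩ C d) → DartIn G
  proper-containment-dart {a} {b} {c} {d} ab cd different (ab⊆cd , x , x∈cd , x∉ab)
    with separator-nonempty ab x
  ... | s , s∈a , s∈b = by-sides (side-of ab (sharing-connected s∈a s∈c)) (side-of ab (sharing-connected s∈a s∈d))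
    where
      nested : ∀ {y} → y ∈ C a → y ∈ C b → y ∈ C c × y ∈ C d
      nested y∈a y∈b = x∈p∩q⁻ (C c) (C d) (ab⊆cd (x∈p∩q⁺ (y∈a , y∈b)))
      s∈c = proj₁ (nested s∈a s∈b)
      s∈d = proj₂ (nested s∈a s∈b)
      x∈c = proj₁ (x∈p∩q⁻ (C c) (C d) x∈cd)
      x∈d = proj₂ (x∈p∩q⁻ (C c) (C d) x∈cd)
      -- If c — d straddled a — b, the tree path from c to d would pass through a and b.
      by-sides : OnSide a b c ⊎ OnSide b a c → OnSide a b d ⊎ OnSide b a d → DartIn G
      by-sides (inj₁ ca) (inj₁ da) =
        nested-labels-dart ab cd ca da nested s∈a s∈b x∈c x∈d (λ x∈ab → x∉ab (x∈p∩q⁺ x∈ab))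
      by-sides (inj₂ cb) (inj₂ db) =
        nested-labels-dart (flipT ab) cd cb db (λ y∈b y∈a → nested y∈a y∈b) s∈b s∈a x∈c x∈d
                           (λ (x∈b , x∈a) → x∉ab (x∈p∩q⁺ (x∈a , x∈b)))
      by-sides (inj₁ ca) (inj₂ db) with path-across ab ca db
      ... | L , w , u , a∈ , b∈ = ⊥-elim (different (on-edge-path (tree-irrefl ab) cd w u a∈ b∈))
      by-sides (inj₂ cb) (inj₁ da) with path-across ab da cb
      ... | L , w , u , a∈ , b∈ with on-edge-path (tree-irrefl ab) (flipT cd) w u a∈ b∈
      ...   | inj₁ (a≡d , b≡c) = ⊥-elim (different (inj₂ (a≡d , b≡c)))
      ...   | inj₂ (a≡c , b≡d) = ⊥-elim (different (inj₁ (a≡c , b≡d)))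

pattern Dt = zero
pattern Dc = suc zero
pattern Dℓ = suc (suc zero)
pattern Dr = suc (suc (suc zero))
pattern Db = suc (suc (suc (suc zero)))

dart-distinguishes : ∀ i j → i ≡ j ⊎ (∃ λ l → dartAdj i l ≢ dartAdj j l) ⊎
                             (i ≡ Dℓ × j ≡ Dr) ⊎ (i ≡ Dr × j ≡ Dℓ)
dart-distinguishes = from-yes (all? λ i → all? λ j →
  (i ≟ j) ⊎-dec any? (λ l → ¬? (dartAdj i l Bool.≟ dartAdj j l)) ⊎-dec
  ((i ≟ Dℓ) ×-dec (j ≟ Dr)) ⊎-dec ((i ≟ Dr) ×-dec (j ≟ Dℓ)))

module DartEmbedding {m : ℕ} {G : Graph m} (D : DartIn G) where
  open DartIn D
  open Cliques G using (flipA)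

  vertex : Fin 5 → Fin m
  vertex Dt = t
  vertex Dc = c
  vertex Dℓ = ℓ
  vertex Dr = r
  vertex Db = b

  private
    true≡ : ∀ {x} → T x → true ≡ x
    true≡ {true} _ = refl
    false≡ : ∀ {x} → ¬ T x → false ≡ x
    false≡ {false} _ = refl
    false≡ {true} ¬x = ⊥-elim (¬x _)
    loop : ∀ v → false ≡ adj G v v
    loop v = sym (Graph.irrefl G v)

  preserves : ∀ i j → dartAdj i j ≡ adj G (vertex i) (vertex j)
  preserves Dt Dt = loop t
  preserves Dt Dc = true≡ t~c
  preserves Dt Dℓ = true≡ t~ℓ
  preserves Dt Dr = true≡ t~r
  preserves Dt Db = false≡ t≁b
  preserves Dc Dt = true≡ (flipA t~c)
  preserves Dc Dc = loop c
  preserves Dc Dℓ = true≡ c~ℓ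
  preserves Dc Dr = true≡ c~r
  preserves Dc Db = true≡ c~b
  preserves Dℓ Dt = true≡ (flipA t~ℓ)
  preserves Dℓ Dc = true≡ (flipA c~ℓ)
  preserves Dℓ Dℓ = loop ℓ
  preserves Dℓ Dr = false≡ ℓ≁r
  preserves Dℓ Db = false≡ ℓ≁b
  preserves Dr Dt = true≡ (flipA t~r)
  preserves Dr Dc = true≡ (flipA c~r)
  preserves Dr Dℓ = false≡ (λ r~ℓ → ℓ≁r (flipA r~ℓ))
  preserves Dr Dr = loop r
  preserves Dr Db = false≡ r≁b
  preserves Db Dt = false≡ (λ b~t → t≁b (flipA b~t))
  preserves Db Dc = true≡ (flipA c~b)
  preserves Db Dℓ = false≡ (λ b~ℓ → ℓ≁b (flipA b~ℓ))
  preserves Db Dr = false≡ (λ b~r → r≁b (flipA b~r))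
  preserves Db Db = loop b

  -- Vertices with the same image have the same neighbourhood, so only ℓ, r could
  -- be identified, and they are distinct.
  injective : Injective _≡_ _≡_ vertex
  injective {i} {j} same with dart-distinguishes i j
  ... | inj₁ i≡j = i≡j
  ... | inj₂ (inj₁ (l , differ)) = ⊥-elim (differ (begin
          dartAdj i l                   ≡⟨ preserves i l ⟩
          adj G (vertex i) (vertex l)   ≡⟨ cong (λ v → adj G v (vertex l)) same ⟩
          adj G (vertex j) (vertex l)   ≡⟨ sym (preserves j l) ⟩
          dartAdj j l                   ∎))
    where open ≡-Reasoning
  ... | inj₂ (inj₂ (inj₁ (refl , refl))) = ⊥-elim (ℓ≢r same)
  ... | inj₂ (inj₂ (inj₂ (refl , refl))) = ⊥-elim (ℓ≢r (sym same))

  embedding : InducedEmbedding dartAdj (adj G) vertex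
  embedding = injective , preserves

embedding-∘ : ∀ {a b c} {h : Fin a → Fin a → Bool} {g : Fin b → Fin b → Bool} {k : Fin c → Fin c → Bool}
              {f : Fin a → Fin b} {e : Fin b → Fin c} →
              InducedEmbedding h g f → InducedEmbedding g k e → InducedEmbedding h k (λ i → e (f i))
embedding-∘ {f = f} (f-inj , f-adj) (e-inj , e-adj) =
  (λ same → f-inj (e-inj same)) , λ i j → trans (f-adj i j) (e-adj (f i) (f j))

-- The star with centre h: exactly one end of every edge is h.
star : ∀ {k} → Fin k → Graph k
star h = record
  { adj = λ i j → is-centre i xor is-centre j
  ; sym = λ i j → xor-comm (is-centre i) (is-centre j)
  ; irrefl = λ i → xor-same (is-centre i)
  }
  where
    is-centre : Fin _ → Bool
    is-centre i = does (i ≟ h)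

module Star {k : ℕ} (h : Fin k) where
  private
    r = adj (star h)
  open SymmetricWalks r (Graph.sym (star h))

  to-centre : ∀ x → x ≢ h → T (r x h)
  to-centre x x≢h rewrite dec-false (x ≟ h) x≢h | dec-true (h ≟ h) refl = _

  -- Only the centre has two distinct neighbours: a leaf is adjacent to h alone.
  branching-centre : ∀ {l} → Branching l → l ≡ h
  branching-centre {l} (x , y , x≢y , lx , ly) with l ≟ h
  ... | yes l≡h = l≡h
  ... | no l≢h = ⊥-elim (x≢y (trans (leaf-neighbour lx) (sym (leaf-neighbour ly))))
    where
      leaf-neighbour : ∀ {z} → T (does (z ≟ h)) → z ≡ h
      leaf-neighbour {z} lz with z ≟ h
      ... | yes z≡h = z≡h
      ... | no _ = ⊥-elim lz

  apart : ∀ {n} {f : Fin n → Fin k} → Injective _≡_ _≡_ f → ∀ {i j} → i ≢ j → f i ≢ f j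
  apart inj i≢j same = i≢j (inj same)

  -- Along a cycle f 0, f 1, f 2, … the vertices f 1 and f 2 are both branching,
  -- hence both equal to the centre.
  is-acyclic : Acyclic (star h)
  is-acyclic zero () _ _ _
  is-acyclic (suc zero) (s≤s ()) _ _ _
  is-acyclic (suc (suc zero)) (s≤s (s≤s ())) _ _ _
  is-acyclic 3 _ f inj cyc =
    apart inj (λ ()) (trans (branching-centre (f zero , f Dℓ , apart inj (λ ()) , cyc Dc zero _ , cyc Dc Dℓ _))
                     (sym (branching-centre (f Dc , f zero , apart inj (λ ()) , cyc Dℓ Dc _ , cyc Dℓ zero _))))
  is-acyclic (suc (suc (suc (suc m)))) _ f inj cyc =
    apart inj (λ ()) (trans (branching-centre (f zero , f Dℓ , apart inj (λ ()) , cyc Dc zero _ , cyc Dc Dℓ _))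
                     (sym (branching-centre (f Dc , f Dr , apart inj (λ ()) , cyc Dℓ Dc _ , cyc Dℓ Dr _))))

  connected : ∀ x y → Walks.Connected r x y
  connected = hub-connects h to-centre

  path-property : ∀ {n} (C : Fin k → Subset n) → (∀ i j → i ≢ j → C i ∩ C j ⊆ C h) →
                  ∀ i j vs → Walk r i j vs → Unique vs → ∀ l → l ∈ₗ vs → C i ∩ C j ⊆ C l
  path-property C centre i j vs w u l l∈ with on-simple-path w u l∈
  ... | inj₁ refl = p∩q⊆p (C i) (C j)
  ... | inj₂ (inj₁ refl) = p∩q⊆q (C i) (C j)
  ... | inj₂ (inj₂ (i≢j , branching)) = λ x∈ij → subst (λ v → _ ∈ C v) (sym (branching-centre branching)) (centre i j i≢j x∈ij)

module CliqueEnumeration {n k : ℕ} (G : Graph n) (C : Fin k → Subset n)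
  (complete : ∀ i → IsComplete G (C i))
  (cover : ∀ S → IsComplete G S → ∃ λ i → S ⊆ C i)
  (antichain : ∀ i j → C i ⊆ C j → i ≡ j) where

  is-clique : ∀ i → IsClique G (C i)
  is-clique i = complete i , maximal
    where
      maximal : ∀ S → IsComplete G S → C i ⊆ S → S ⊆ C i
      maximal S complete-S Ci⊆S with cover S complete-S
      ... | j , S⊆Cj with antichain i j (λ z → S⊆Cj (Ci⊆S z))
      ...   | refl = S⊆Cj

  injective : Injective _≡_ _≡_ C
  injective {i} {j} Ci≡Cj = antichain i j (subst (λ D → C i ⊆ D) Ci≡Cj id)

  exhaustive : ∀ S → IsClique G S → ∃ λ i → C i ≡ S
  exhaustive S (complete-S , maximal-S) with cover S complete-S
  ... | i , S⊆Ci = i , ⊆-antisym (maximal-S (C i) (complete i) S⊆Ci) S⊆Ci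

all-subsets? : ∀ {n} {P : Subset n → Set} → (∀ S → Dec (P S)) → Dec (∀ S → P S)
all-subsets? P? with anySubset? (λ S → ¬? (P? S))
... | yes (S , ¬PS) = no λ all → ¬PS (all S)
... | no none = yes λ S → decidable-stable (P? S) λ ¬PS → none (S , ¬PS)

-- The dart as a graph, and its clique forest: the cliques {c, b}, {t, c, ℓ},
-- {t, c, r} on the star centred at {t, c, ℓ}, with labels {c} and {t, c}.
dart : Graph 5
dart = record
  { adj = dartAdj
  ; sym = from-yes (all? λ x → all? λ y → dartAdj x y Bool.≟ dartAdj y x)
  ; irrefl = from-yes (all? λ x → dartAdj x x Bool.≟ false)
  }

dart-cliques : Fin 3 → Subset 5
dart-cliques zero = outside ∷ inside ∷ outside ∷ outside ∷ inside ∷ []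
dart-cliques (suc zero) = inside ∷ inside ∷ inside ∷ outside ∷ outside ∷ []
dart-cliques (suc (suc zero)) = inside ∷ inside ∷ outside ∷ inside ∷ outside ∷ []

module DartCliques = CliqueEnumeration dart dart-cliques
  (from-yes (all? λ i → Cliques.complete? dart (dart-cliques i)))
  (from-yes (all-subsets? λ S → Cliques.complete? dart S →-dec any? λ i → S ⊆? dart-cliques i))
  (from-yes (all? λ i → all? λ j → (dart-cliques i ⊆? dart-cliques j) →-dec (i ≟ j)))

dart-clique-forest : CliqueForest dart
dart-clique-forest = record
  { k = 3
  ; clq = dart-cliques
  ; clq-clique = DartCliques.is-clique
  ; clq-inj = DartCliques.injective
  ; clq-all = DartCliques.exhaustive
  ; tree = star (suc zero)
  ; acyclic = Star.is-acyclic (suc zero)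
  ; components = λ i j → mk⇔ (λ _ x y _ _ → SymmetricWalks.hub-connects dartAdj (Graph.sym dart) Dc c-universal x y)
                              (λ _ → Star.connected (suc zero) i j)
  ; path-prop = Star.path-property (suc zero) dart-cliques
      (from-yes (all? λ i → all? λ j → ¬? (i ≟ j) →-dec (dart-cliques i ∩ dart-cliques j ⊆? dart-cliques (suc zero))))
  }
  where
    c-universal : ∀ x → x ≢ Dc → T (dartAdj x Dc)
    c-universal = from-yes (all? λ x → ¬? (x ≟ Dc) →-dec T? (dartAdj x Dc))

lemma2p4 : ∀ (n : ℕ) (G : Graph n) → Chordal G → (NoProperSepContainment G ⇔ DartFree G)
lemma2p4 n G _ = mk⇔ dart-free no-proper-containment
  where
    dart-free : NoProperSepContainment G → DartFree G
    dart-free no-containment f f-embeds =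
      no-containment 5 dart (f , f-embeds) dart-clique-forest zero (suc zero) (suc zero) (suc (suc zero)) _ _
        (λ { (inj₁ (() , _)) ; (inj₂ (() , _)) })
        (from-yes (dart-cliques zero ∩ dart-cliques (suc zero) ⊂? dart-cliques (suc zero) ∩ dart-cliques (suc (suc zero))))

    no-proper-containment : DartFree G → NoProperSepContainment G
    no-proper-containment free m G' (g , g-embeds) F a b c d ab cd different proper =
      free _ (embedding-∘ {k = adj G} embedding g-embeds)
      where open DartEmbedding (DartFromLabels.proper-containment-dart G' F ab cd different proper)
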